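{- Let $w,w'$ be signed $\mathbf A$-words such that $w$ is right-$\mathbf R$-reversible or left-$\mathbf R$-reversible to $w'$. Then for every tree $T$ such that $T*w$ is defined, $T*w'$ is defined as well.
   Context: Trees: finite binary rooted trees; $\bullet$ is the one-leaf tree and $T_0\wedge T_1$ the tree with left subtree $T_0$ and right subtree $T_1$. Addresses are finite words over $\{0,1\}$; the $\alpha$-subtree of $T$: the $\emptyset$-subtree is $T$, and for $T=T_0\wedge T_1$ the $i\beta$-subtree is the $\beta$-subtree of $T_i$. For a letter $a_\alpha$, $T*a_\alpha$ is defined iff the $\alpha$-subtree of $T$ has the form $T_0\wedge(T_1\wedge T_2)$, and then it is $T$ with that subtree replaced by $(T_0\wedge T_1)\wedge T_2$ (left rotation at $\alpha$); $T*a_\alpha^{ -1}=U$ iff $U*a_\alpha=T$ (defined iff the $\alpha$-subtree of $T$ has the form $(T_0\wedge T_1)\wedge T_2$). For a signed word $w=x_1\cdots x_m$ (letters $a_\alpha^{\pm1}$), $T*w$ is defined if $T*x_1$, $(T*x_1)*x_2$, …, $(\cdots(T*x_1)\cdots)*x_m$ are all defined. $\mathbf A=\{a_\alpha\}$; addresses $\alpha\perp\beta$ (orthogonal) if some $\gamma$ has $\alpha$ beginning with $\gamma0$ and $\beta$ with $\gamma1$ or vice versa. $\mathbf R$: for all $\alpha,\beta$, $a_\alpha a_\beta=a_\beta a_\alpha$ ($\alpha\perp\beta$); $a_{\alpha11\beta}a_\alpha=a_\alpha a_{\alpha1\beta}$; $a_{\alpha10\beta}a_\alpha=a_\alpha a_{\alpha01\beta}$;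 $a_{\alpha0\beta}a_\alpha=a_\alpha a_{\alpha00\beta}$; $a_\alpha^2=a_{\alpha1}a_\alpha a_{\alpha0}$. Right-$\mathbf R$-reversing step: delete a factor $a^{ -1}a$, or replace a factor $a^{ -1}b$ by $vu^{ -1}$ with $u,v$ positive words such that $av=bu$ is a relation of $\mathbf R$ (either orientation). Left-$\mathbf R$-reversing step: delete a factor $aa^{ -1}$, or replace a factor $ab^{ -1}$ by $u^{ -1}v$ with $ua=vb$ a relation of $\mathbf R$ (either orientation). "Reversible to" means by finitely many such steps. -}

module Defs where

open import Data.Bool using (Bool; true; false)
open import Data.List using (List; []; _∷_; _++_; map; reverse)
open import Data.Maybe using (Maybe; just; nothing; _>>=_; Is-just)
open import Data.Product using (∃; ∃-syntax; _×_; _,_)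
open import Data.Sum using (_⊎_)
open import Relation.Binary.PropositionalEquality using (_≡_)
open import Relation.Binary.Construct.Closure.ReflexiveTransitive using (Star)

infixr 5 _∧_
data Tree : Set where
  • : Tree
  _∧_ : Tree → Tree → Tree

-- addresses: finite words over {0,1}; the letter 0 is `false`, 1 is `true`
Addr : Set
Addr = List Bool

0' 1' : Bool
0' = false
1' = true

rot : Addr → Tree → Maybe Tree
rot [] (T0 ∧ (T1 ∧ T2)) = just ((T0 ∧ T1) ∧ T2)
rot [] _ = nothing
rot (false ∷ α) (L ∧ R) = Data.Maybe.map (λ L' → L' ∧ R) (rot α L)
rot (true ∷ α) (L ∧ R) = Data.Maybe.map (λ R' → L ∧ R') (rot α R)
rot (_ ∷ _) • = nothing

-- inverse rotation at α:  (T0 ∧ T1) ∧ T2 ↦ T0 ∧ (T1 ∧ T2) at the α-subtree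
-- (this is exactly the U with U * a_α = T; defined iff the α-subtree has that form)
rot⁻ : Addr → Tree → Maybe Tree
rot⁻ [] ((T0 ∧ T1) ∧ T2) = just (T0 ∧ (T1 ∧ T2))
rot⁻ [] _ = nothing
rot⁻ (false ∷ α) (L ∧ R) = Data.Maybe.map (λ L' → L' ∧ R) (rot⁻ α L)
rot⁻ (true ∷ α) (L ∧ R) = Data.Maybe.map (λ R' → L ∧ R') (rot⁻ α R)
rot⁻ (_ ∷ _) • = nothing

data Letter : Set where
  pos : Addr → Letter
  neg : Addr → Letter

PWord : Set
PWord = List Addr

SWord : Set
SWord = List Letter

⟦_⟧⁺ : PWord → SWord
⟦ u ⟧⁺ = map pos u

⟦_⟧⁻ : PWord → SWord
⟦ u ⟧⁻ = map neg (reverse u)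

_*ₗ_ : Tree → Letter → Maybe Tree
T *ₗ pos α = rot α T
T *ₗ neg α = rot⁻ α T

_*_ : Tree → SWord → Maybe Tree
T * [] = just T
T * (x ∷ w) = (T *ₗ x) >>= λ U → U * w

Defined : Maybe Tree → Set
Defined m = Is-just m

_⊥_ : Addr → Addr → Set
α ⊥ β = ∃[ γ ] ∃[ α' ] ∃[ β' ]
  ((α ≡ γ ++ (0' ∷ α') × β ≡ γ ++ (1' ∷ β')) ⊎ (α ≡ γ ++ (1' ∷ α') × β ≡ γ ++ (0' ∷ β')))

data RelR : PWord → PWord → Set where
  comm : ∀ {α β} → α ⊥ β → RelR (α ∷ β ∷ []) (β ∷ α ∷ [])
  r11  : ∀ α β → RelR ((α ++ 1' ∷ 1' ∷ β) ∷ α ∷ []) (α ∷ (α ++ 1' ∷ β) ∷ [])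
  r10  : ∀ α β → RelR ((α ++ 1' ∷ 0' ∷ β) ∷ α ∷ []) (α ∷ (α ++ 0' ∷ 1' ∷ β) ∷ [])
  r0   : ∀ α β → RelR ((α ++ 0' ∷ β) ∷ α ∷ []) (α ∷ (α ++ 0' ∷ 0' ∷ β) ∷ [])
  sq   : ∀ α → RelR (α ∷ α ∷ []) ((α ++ 1' ∷ []) ∷ α ∷ (α ++ 0' ∷ []) ∷ [])

RelR± : PWord → PWord → Set
RelR± u v = RelR u v ⊎ RelR v u

data RStep : SWord → SWord → Set where
  del : ∀ p s a → RStep (p ++ neg a ∷ pos a ∷ s) (p ++ s)
  rep : ∀ p s a b u v → RelR± (a ∷ v) (b ∷ u) →
        RStep (p ++ neg a ∷ pos b ∷ s) (p ++ ⟦ v ⟧⁺ ++ ⟦ u ⟧⁻ ++ s)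

data LStep : SWord → SWord → Set where
  del : ∀ p s a → LStep (p ++ pos a ∷ neg a ∷ s) (p ++ s)
  rep : ∀ p s a b u v → RelR± (u ++ a ∷ []) (v ++ b ∷ []) →
        LStep (p ++ pos a ∷ neg b ∷ s) (p ++ ⟦ u ⟧⁻ ++ ⟦ v ⟧⁺ ++ s)

RRev : SWord → SWord → Set
RRev = Star RStep

LRev : SWord → SWord → Set
LRev = Star LStep

module Submission where

-- Write  w ⊑ w'  when every tree transformation realised by w is also realised
-- by w' (T * w = U implies T * w' = U).  This relation is reflexive,
-- transitive and compatible with concatenation, so it suffices to show that a
-- single reversing step replaces a factor by a ⊑-larger one.
--  * Deleting x x⁻¹ (or x⁻¹ x) is harmless because letters act by mutually
--    inverse partial bijections.
--  * For the replacements, call positive words u, v "confluent" when every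
--    tree on which the first letters of u and v both act is sent by u and v to
--    one and the same tree, and likewise for u⁻¹, v⁻¹.  Every relation of R is
--    confluent: checked directly at the root address, and transported to an
--    arbitrary address α because acting below α only touches the α-subtree.
--    Confluence of x·w = y·w' turns x⁻¹y into w·w'⁻¹ without losing any
--    transformation, which covers right replacements (x = a, y = b) and, using
--    the inverse words, left replacements (x = a⁻¹, y = b⁻¹).
-- Hence w ⊑ w' whenever w reverses to w', and the theorem follows.

open import Data.Bool using (Bool; true; false)
open import Data.List using ([]; _∷_; _++_; map; reverse; take)
open import Data.List.Properties
  using (map-∘; reverse-map; reverse-++; reverse-involutive; unfold-reverse; take-map; ++-assoc)
open import Data.Maybe using (Maybe; just; nothing; _>>=_)
import Data.Maybe as Maybe
open import Data.Maybe.Relation.Unary.Any using (just)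
open import Data.Product using (∃-syntax; _×_; _,_)
open import Data.Sum using (_⊎_; inj₁; inj₂)
open import Data.Unit using (tt)
open import Relation.Binary.PropositionalEquality
  using (_≡_; refl; sym; trans; cong; subst; subst₂; module ≡-Reasoning)
open import Relation.Binary.Construct.Closure.ReflexiveTransitive using (Star; fold)

open import Defs

*-++ : ∀ T w w' → T * (w ++ w') ≡ (T * w >>= λ U → U * w')
*-++ T [] w' = refl
*-++ T (x ∷ w) w' with T *ₗ x
... | nothing = refl
... | just U = *-++ U w w'

*-++-just : ∀ {T U} w w' → T * w ≡ just U → T * (w ++ w') ≡ U * w'
*-++-just {T} w w' e rewrite *-++ T w w' | e = refl

*-++-split : ∀ {T Z} w w' → T * (w ++ w') ≡ just Z → ∃[ U ] T * w ≡ just U × U * w' ≡ just Z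
*-++-split {T} w w' e with T * w | trans (sym (*-++ T w w')) e
... | just U | e' = U , refl , e'

*-∷ : ∀ {T U} x w → T *ₗ x ≡ just U → T * (x ∷ w) ≡ U * w
*-∷ x w e rewrite e = refl

*-∷-split : ∀ {T Z} x w → T * (x ∷ w) ≡ just Z → ∃[ U ] T *ₗ x ≡ just U × U * w ≡ just Z
*-∷-split {T} x w e with T *ₗ x
... | just U = U , refl , e

defined : ∀ {m : Maybe Tree} {U} → m ≡ just U → Defined m
defined refl = just tt

rot-inverse : ∀ α {T U} → rot α T ≡ just U → rot⁻ α U ≡ just T
rot-inverse [] {T0 ∧ (T1 ∧ T2)} refl = refl
rot-inverse (false ∷ α) {L ∧ R} e with rot α L in e'
rot-inverse (false ∷ α) {L ∧ R} refl | just L' rewrite rot-inverse α e' = refl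
rot-inverse (true ∷ α) {L ∧ R} e with rot α R in e'
rot-inverse (true ∷ α) {L ∧ R} refl | just R' rewrite rot-inverse α e' = refl

rot⁻-inverse : ∀ α {T U} → rot⁻ α T ≡ just U → rot α U ≡ just T
rot⁻-inverse [] {(T0 ∧ T1) ∧ T2} refl = refl
rot⁻-inverse (false ∷ α) {L ∧ R} e with rot⁻ α L in e'
rot⁻-inverse (false ∷ α) {L ∧ R} refl | just L' rewrite rot⁻-inverse α e' = refl
rot⁻-inverse (true ∷ α) {L ∧ R} e with rot⁻ α R in e'
rot⁻-inverse (true ∷ α) {L ∧ R} refl | just R' rewrite rot⁻-inverse α e' = refl

flip : Letter → Letter
flip (pos α) = neg α
flip (neg α) = pos α

letter-inverse : ∀ x {T U} → T *ₗ x ≡ just U → U *ₗ flip x ≡ just T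
letter-inverse (pos α) = rot-inverse α
letter-inverse (neg α) = rot⁻-inverse α

letter-inverse⁻ : ∀ x {T U} → T *ₗ flip x ≡ just U → U *ₗ x ≡ just T
letter-inverse⁻ (pos α) = rot⁻-inverse α
letter-inverse⁻ (neg α) = rot-inverse α

inverse : SWord → SWord
inverse w = reverse (map flip w)

inverse-action : ∀ w {T U} → T * w ≡ just U → U * inverse w ≡ just T
inverse-action [] refl = refl
inverse-action (x ∷ w) {T} {U} e with *-∷-split x w e
... | V , e₁ , e₂ = begin
  U * inverse (x ∷ w)            ≡⟨ cong (U *_) (unfold-reverse (flip x) (map flip w)) ⟩
  U * (inverse w ++ flip x ∷ []) ≡⟨ *-++-just (inverse w) _ (inverse-action w e₂) ⟩
  V * (flip x ∷ [])              ≡⟨ *-∷ (flip x) [] (letter-inverse x e₁) ⟩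
  just T                         ∎
  where open ≡-Reasoning

inverse-pos : ∀ u → inverse ⟦ u ⟧⁺ ≡ ⟦ u ⟧⁻
inverse-pos u = trans (cong reverse (sym (map-∘ u))) (sym (reverse-map neg u))

inverse-neg : ∀ u → inverse ⟦ u ⟧⁻ ≡ ⟦ u ⟧⁺
inverse-neg u = begin
  reverse (map flip (map neg (reverse u))) ≡⟨ cong reverse (sym (map-∘ (reverse u))) ⟩
  reverse (map pos (reverse u))            ≡⟨ sym (reverse-map pos (reverse u)) ⟩
  map pos (reverse (reverse u))            ≡⟨ cong (map pos) (reverse-involutive u) ⟩
  map pos u                                ∎
  where open ≡-Reasoning

-- The inverse of u·a begins with a⁻¹; this exposes the letter a left reversing acts on.
⟦⟧⁻-∷ʳ : ∀ u a → ⟦ u ++ a ∷ [] ⟧⁻ ≡ neg a ∷ ⟦ u ⟧⁻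
⟦⟧⁻-∷ʳ u a = cong (map neg) (reverse-++ u (a ∷ []))

record _⊑_ (w w' : SWord) : Set where
  constructor refines
  field apply : ∀ {T U} → T * w ≡ just U → T * w' ≡ just U
open _⊑_

⊑-refl : ∀ {w} → w ⊑ w
⊑-refl = refines λ e → e

⊑-trans : ∀ {w₁ w₂ w₃} → w₁ ⊑ w₂ → w₂ ⊑ w₃ → w₁ ⊑ w₃
⊑-trans h h' = refines λ e → apply h' (apply h e)

⊑-prefix : ∀ {w w'} p → w ⊑ w' → (p ++ w) ⊑ (p ++ w')
⊑-prefix [] h = h
⊑-prefix {w} {w'} (x ∷ p) h = refines step
  where
  step : ∀ {T U} → T * (x ∷ p ++ w) ≡ just U → T * (x ∷ p ++ w') ≡ just U
  step e with V , e₁ , e₂ ← *-∷-split x (p ++ w) e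
    = trans (*-∷ x (p ++ w') e₁) (apply (⊑-prefix p h) e₂)

⊑-suffix : ∀ {w w'} s → w ⊑ w' → (w ++ s) ⊑ (w' ++ s)
⊑-suffix {w} {w'} s h = refines step
  where
  step : ∀ {T U} → T * (w ++ s) ≡ just U → T * (w' ++ s) ≡ just U
  step e with V , e₁ , e₂ ← *-++-split w s e
    = trans (*-++-just w' s (apply h e₁)) e₂

⊑-context : ∀ {w w'} p s → w ⊑ w' → (p ++ w ++ s) ⊑ (p ++ w' ++ s)
⊑-context p s h = ⊑-prefix p (⊑-suffix s h)

⊑-defined : ∀ {w w' T} → w ⊑ w' → Defined (T * w) → Defined (T * w')
⊑-defined {w} {T = T} h d with T * w in e
... | just U = defined (apply h e)

cancel-⊑ : ∀ x → (x ∷ flip x ∷ []) ⊑ []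
cancel-⊑ x = refines cancel
  where
  cancel : ∀ {T U} → T * (x ∷ flip x ∷ []) ≡ just U → T * [] ≡ just U
  cancel e with V , e₁ , e₂ ← *-∷-split x (flip x ∷ []) e
    = trans (sym (*-∷ (flip x) [] (letter-inverse x e₁))) e₂

record Joinable (w w' : SWord) : Set where
  field
    joinAt : ∀ T → Defined (T * take 1 w) → Defined (T * take 1 w') →
             ∃[ X ] T * w ≡ just X × T * w' ≡ just X
open Joinable

Joinable-sym : ∀ {w w'} → Joinable w w' → Joinable w' w
Joinable-sym j .joinAt T d d' with joinAt j T d' d
... | X , e , e' = X , e' , e

-- If x·w and y·w' are joinable, replacing x⁻¹y by w·w'⁻¹ refines the action:
-- this is the reversing replacement in its common right/left form.
joinable-⊑ : ∀ {x y w w'} → Joinable (x ∷ w) (y ∷ w') → (flip x ∷ y ∷ []) ⊑ (w ++ inverse w')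
joinable-⊑ {x} {y} {w} {w'} j = refines replace
  where
  replace : ∀ {T U} → T * (flip x ∷ y ∷ []) ≡ just U → T * (w ++ inverse w') ≡ just U
  replace e
    with V , e₁ , e₂ ← *-∷-split (flip x) (y ∷ []) e
    with W , e₃ , refl ← *-∷-split y [] e₂
    with back ← letter-inverse⁻ x e₁
    with X , e₄ , e₅ ← joinAt j V (defined (*-∷ x [] back)) (defined (*-∷ y [] e₃))
    = trans (*-++-just w (inverse w') (trans (sym (*-∷ x w back)) e₄))
            (inverse-action w' (trans (sym (*-∷ y w' e₃)) e₅))

push : Bool → Letter → Letter
push c (pos α) = pos (c ∷ α)
push c (neg α) = neg (c ∷ α)

branch : Bool → Tree → Tree → Tree
branch false L R = L
branch true L R = R

graft : Bool → Tree → Tree → Tree → Tree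
graft false L R S = S ∧ R
graft true L R S = L ∧ S

*ₗ-push : ∀ c x L R → (L ∧ R) *ₗ push c x ≡ Maybe.map (graft c L R) (branch c L R *ₗ x)
*ₗ-push false (pos α) L R = refl
*ₗ-push false (neg α) L R = refl
*ₗ-push true (pos α) L R = refl
*ₗ-push true (neg α) L R = refl

*-push : ∀ c w L R → (L ∧ R) * map (push c) w ≡ Maybe.map (graft c L R) (branch c L R * w)
*-push false [] L R = refl
*-push true [] L R = refl
*-push false (x ∷ w) L R rewrite *ₗ-push false x L R with L *ₗ x
... | nothing = refl
... | just L' = *-push false w L' R
*-push true (x ∷ w) L R rewrite *ₗ-push true x L R with R *ₗ x
... | nothing = refl
... | just R' = *-push true w L R'

stuck-at-leaf : ∀ c w → Defined (• * take 1 (map (push c) w)) → w ≡ []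
stuck-at-leaf c [] _ = refl
stuck-at-leaf false (pos α ∷ w) ()
stuck-at-leaf false (neg α ∷ w) ()
stuck-at-leaf true (pos α ∷ w) ()
stuck-at-leaf true (neg α ∷ w) ()

defined-map⁻ : ∀ {f : Tree → Tree} {m} → Defined (Maybe.map f m) → Defined m
defined-map⁻ {m = just _} _ = just tt

descend : ∀ c w L R → Defined ((L ∧ R) * take 1 (map (push c) w)) → Defined (branch c L R * take 1 w)
descend c w L R d = defined-map⁻ (subst Defined
  (trans (cong ((L ∧ R) *_) (take-map 1 w)) (*-push c (take 1 w) L R)) d)

ascend : ∀ c w L R {X} → branch c L R * w ≡ just X → (L ∧ R) * map (push c) w ≡ just (graft c L R X)
ascend c w L R e = trans (*-push c w L R) (cong (Maybe.map (graft c L R)) e)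

push-joinable : ∀ c {w w'} → Joinable w w' → Joinable (map (push c) w) (map (push c) w')
push-joinable c {w} {w'} j .joinAt • d d'
  rewrite stuck-at-leaf c w d | stuck-at-leaf c w' d' = • , refl , refl
push-joinable c {w} {w'} j .joinAt (L ∧ R) d d'
  with X , e , e' ← joinAt j (branch c L R) (descend c w L R d) (descend c w' L R d')
  = graft c L R X , ascend c w L R e , ascend c w' L R e'

record Confluent (u v : PWord) : Set where
  field
    right : Joinable ⟦ u ⟧⁺ ⟦ v ⟧⁺
    left  : Joinable ⟦ u ⟧⁻ ⟦ v ⟧⁻
open Confluent

Confluent-sym : ∀ {u v} → Confluent u v → Confluent v u
Confluent-sym k .right = Joinable-sym (right k)
Confluent-sym k .left = Joinable-sym (left k)

push-pos : ∀ c u → ⟦ map (c ∷_) u ⟧⁺ ≡ map (push c) ⟦ u ⟧⁺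
push-pos c u = trans (sym (map-∘ u)) (map-∘ u)

push-neg : ∀ c u → ⟦ map (c ∷_) u ⟧⁻ ≡ map (push c) ⟦ u ⟧⁻
push-neg c u = trans (cong (map neg) (sym (reverse-map (c ∷_) u)))
                     (trans (sym (map-∘ (reverse u))) (map-∘ (reverse u)))

push-confluent : ∀ c {u v} → Confluent u v → Confluent (map (c ∷_) u) (map (c ∷_) v)
push-confluent c {u} {v} k .right =
  subst₂ Joinable (sym (push-pos c u)) (sym (push-pos c v)) (push-joinable c (right k))
push-confluent c {u} {v} k .left =
  subst₂ Joinable (sym (push-neg c u)) (sym (push-neg c v)) (push-joinable c (left k))

commute-root : ∀ α β → Confluent ((0' ∷ α) ∷ (1' ∷ β) ∷ []) ((1' ∷ β) ∷ (0' ∷ α) ∷ [])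
commute-root α β .right .joinAt • () _
commute-root α β .right .joinAt (L ∧ R) _ _ with rot α L in e
... | just L' with rot β R
... | just R' rewrite e = _ , refl , refl
commute-root α β .left .joinAt • () _
commute-root α β .left .joinAt (L ∧ R) _ _ with rot⁻ α L in e
... | just L' with rot⁻ β R
... | just R' rewrite e = _ , refl , refl

r11-root : ∀ β → Confluent ((1' ∷ 1' ∷ β) ∷ [] ∷ []) ([] ∷ (1' ∷ β) ∷ [])
r11-root β .right .joinAt • _ ()
r11-root β .right .joinAt (T0 ∧ •) _ ()
r11-root β .right .joinAt (T0 ∧ (T1 ∧ T2)) _ _ with rot β T2
... | just _ = _ , refl , refl
r11-root β .left .joinAt • () _
r11-root β .left .joinAt (• ∧ T2) () _
r11-root β .left .joinAt ((T0 ∧ T1) ∧ T2) _ _ with rot⁻ β T2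
... | just _ = _ , refl , refl

r10-root : ∀ β → Confluent ((1' ∷ 0' ∷ β) ∷ [] ∷ []) ([] ∷ (0' ∷ 1' ∷ β) ∷ [])
r10-root β .right .joinAt • _ ()
r10-root β .right .joinAt (T0 ∧ •) _ ()
r10-root β .right .joinAt (T0 ∧ (T1 ∧ T2)) _ _ with rot β T1
... | just _ = _ , refl , refl
r10-root β .left .joinAt • () _
r10-root β .left .joinAt (• ∧ T2) () _
r10-root β .left .joinAt ((T0 ∧ T1) ∧ T2) _ _ with rot⁻ β T1
... | just _ = _ , refl , refl

r0-root : ∀ β → Confluent ((0' ∷ β) ∷ [] ∷ []) ([] ∷ (0' ∷ 0' ∷ β) ∷ [])
r0-root β .right .joinAt • _ ()
r0-root β .right .joinAt (T0 ∧ •) _ ()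
r0-root β .right .joinAt (T0 ∧ (T1 ∧ T2)) _ _ with rot β T0
... | just _ = _ , refl , refl
r0-root β .left .joinAt • () _
r0-root β .left .joinAt (• ∧ T2) () _
r0-root β .left .joinAt ((T0 ∧ T1) ∧ T2) _ _ with rot⁻ β T0
... | just _ = _ , refl , refl

square-root : Confluent ([] ∷ [] ∷ []) ((1' ∷ []) ∷ [] ∷ (0' ∷ []) ∷ [])
square-root .right .joinAt • () _
square-root .right .joinAt (T0 ∧ •) () _
square-root .right .joinAt (T0 ∧ (T1 ∧ •)) _ ()
square-root .right .joinAt (T0 ∧ (T1 ∧ (T2 ∧ T3))) _ _ = _ , refl , refl
square-root .left .joinAt • () _
square-root .left .joinAt (• ∧ T2) () _
square-root .left .joinAt ((• ∧ T1) ∧ T2) _ ()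
square-root .left .joinAt (((T0 ∧ T1) ∧ T2) ∧ T3) _ _ = _ , refl , refl

commute-confluent : ∀ γ α β →
  Confluent ((γ ++ 0' ∷ α) ∷ (γ ++ 1' ∷ β) ∷ []) ((γ ++ 1' ∷ β) ∷ (γ ++ 0' ∷ α) ∷ [])
commute-confluent [] α β = commute-root α β
commute-confluent (c ∷ γ) α β = push-confluent c (commute-confluent γ α β)

r11-confluent : ∀ α β → Confluent ((α ++ 1' ∷ 1' ∷ β) ∷ α ∷ []) (α ∷ (α ++ 1' ∷ β) ∷ [])
r11-confluent [] β = r11-root β
r11-confluent (c ∷ α) β = push-confluent c (r11-confluent α β)

r10-confluent : ∀ α β → Confluent ((α ++ 1' ∷ 0' ∷ β) ∷ α ∷ []) (α ∷ (α ++ 0' ∷ 1' ∷ β) ∷ [])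
r10-confluent [] β = r10-root β
r10-confluent (c ∷ α) β = push-confluent c (r10-confluent α β)

r0-confluent : ∀ α β → Confluent ((α ++ 0' ∷ β) ∷ α ∷ []) (α ∷ (α ++ 0' ∷ 0' ∷ β) ∷ [])
r0-confluent [] β = r0-root β
r0-confluent (c ∷ α) β = push-confluent c (r0-confluent α β)

square-confluent : ∀ α → Confluent (α ∷ α ∷ []) ((α ++ 1' ∷ []) ∷ α ∷ (α ++ 0' ∷ []) ∷ [])
square-confluent [] = square-root
square-confluent (c ∷ α) = push-confluent c (square-confluent α)

confluent : ∀ {u v} → RelR u v → Confluent u v
confluent (comm (γ , α , β , inj₁ (refl , refl))) = commute-confluent γ α β
confluent (comm (γ , α , β , inj₂ (refl , refl))) = Confluent-sym (commute-confluent γ β α)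
confluent (r11 α β) = r11-confluent α β
confluent (r10 α β) = r10-confluent α β
confluent (r0 α β) = r0-confluent α β
confluent (sq α) = square-confluent α

confluent± : ∀ {u v} → RelR± u v → Confluent u v
confluent± (inj₁ r) = confluent r
confluent± (inj₂ r) = Confluent-sym (confluent r)

right-replacement-⊑ : ∀ {a b u v} → RelR± (a ∷ v) (b ∷ u) →
  (neg a ∷ pos b ∷ []) ⊑ (⟦ v ⟧⁺ ++ ⟦ u ⟧⁻)
right-replacement-⊑ {u = u} {v} r =
  subst (λ z → _ ⊑ (⟦ v ⟧⁺ ++ z)) (inverse-pos u) (joinable-⊑ (right (confluent± r)))

left-replacement-⊑ : ∀ {a b u v} → RelR± (u ++ a ∷ []) (v ++ b ∷ []) →
  (pos a ∷ neg b ∷ []) ⊑ (⟦ u ⟧⁻ ++ ⟦ v ⟧⁺)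
left-replacement-⊑ {a} {b} {u} {v} r =
  subst (λ z → _ ⊑ (⟦ u ⟧⁻ ++ z)) (inverse-neg v) (joinable-⊑ joinable)
  where
  joinable : Joinable (neg a ∷ ⟦ u ⟧⁻) (neg b ∷ ⟦ v ⟧⁻)
  joinable = subst₂ Joinable (⟦⟧⁻-∷ʳ u a) (⟦⟧⁻-∷ʳ v b) (left (confluent± r))

right-step-⊑ : ∀ {w w'} → RStep w w' → w ⊑ w'
right-step-⊑ (del p s a) = ⊑-context p s (cancel-⊑ (neg a))
right-step-⊑ (rep p s a b u v r) =
  subst (λ z → _ ⊑ (p ++ z)) (++-assoc ⟦ v ⟧⁺ ⟦ u ⟧⁻ s) (⊑-context p s (right-replacement-⊑ r))

left-step-⊑ : ∀ {w w'} → LStep w w' → w ⊑ w'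
left-step-⊑ (del p s a) = ⊑-context p s (cancel-⊑ (pos a))
left-step-⊑ (rep p s a b u v r) =
  subst (λ z → _ ⊑ (p ++ z)) (++-assoc ⟦ u ⟧⁻ ⟦ v ⟧⁺ s) (⊑-context p s (left-replacement-⊑ r))

steps-⊑ : ∀ {Step : SWord → SWord → Set} → (∀ {w w'} → Step w w' → w ⊑ w') →
  ∀ {w w'} → Star Step w w' → w ⊑ w'
steps-⊑ step = fold _⊑_ (λ s h → ⊑-trans (step s) h) ⊑-refl

lemma3p16 : (w w' : SWord) → RRev w w' ⊎ LRev w w' →
    (T : Tree) → Defined (T * w) → Defined (T * w')
lemma3p16 w w' (inj₁ r) T = ⊑-defined (steps-⊑ right-step-⊑ r)
lemma3p16 w w' (inj₂ r) T = ⊑-defined (steps-⊑ left-step-⊑ r)
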